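{- Any deterministic algorithm for hypergraph orientation under explorable uncertainty with predictions has competitive ratio at least $2$ on the class of instances with $k_{\#} \geq 1$; that is, for every deterministic algorithm and every $\rho<2$ there is an instance with $k_\#\ge 1$ on which the algorithm makes more than $\rho\cdot|\mathrm{OPT}|$ queries. This holds even for instances whose hypergraph is a simple (non-hyper) graph.
   Context: Hypergraph orientation under explorable uncertainty: an instance is a hypergraph $H=(V,E)$ together with, for every vertex $v$, an uncertainty interval $I_v$, either an open interval $(L_v,U_v)$ or a trivial interval $[w_v]$, and a precise weight $w_v \in I_v$ unknown until $v$ is queried; querying reveals $w_v$ and replaces $I_v$ by $[w_v]$. A hyperedge $S$ is solved w.r.t. the current intervals if some $v\in S$ has $U_v\le L_u$ for all $u\in S\setminus\{v\}$. A set is feasible if querying it solves all hyperedges; $\mathrm{OPT}$ is a minimum feasible set. An algorithm adaptively queries until all hyperedges are solved; it has competitive ratio $\rho$ if it makes at most $\rho|\mathrm{OPT}|$ queries on every instance. In the prediction setting the algorithm also receives predicted weights $\tilde w_v\in I_v$. The error $k_\#$ is the number of vertices $v$ with $w_v \ne \tilde w_v$.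
   Formalization: The ratio ρ ranges over the rationals, and the precise weights, predicted weights and interval endpoints of the instances are taken in the rationals. -}

module Defs where

open import Data.Bool using (Bool; true; false; if_then_else_)
open import Data.Nat as ℕ using (ℕ; zero; suc)
open import Data.Integer using (+_)
open import Data.Rational using (ℚ; _<_; _≤_; _/_; _*_)
open import Data.Rational.Properties using (_≤?_; _≟_)
open import Data.Fin using (Fin) renaming (_≟_ to _≟ᶠ_)
import Data.Fin
open import Data.Fin.Subset using (Subset; ∣_∣)
open import Data.Vec using (lookup)
open import Data.List using (List; []; _∷_; _++_; map; length; filter; allFin)
open import Data.List.Relation.Unary.All using (All; all?)
open import Data.List.Relation.Unary.Any using (Any; any?)
open import Data.List.Relation.Unary.Unique.Propositional using (Unique)
open import Data.Maybe using (Maybe; just; nothing)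
open import Data.Product using (Σ; ∃₂; _×_; _,_; proj₁)
open import Relation.Binary.PropositionalEquality using (_≡_; _≢_)
open import Relation.Nullary using (¬_; Dec; yes; no; does; ¬?)
open import Relation.Nullary.Decidable using (_→-dec_)

data Interval : Set where
  open′   : (L U : ℚ) → L < U → Interval
  trivial : ℚ → Interval

Lo : Interval → ℚ
Lo (open′ L U _) = L
Lo (trivial x)   = x

Up : Interval → ℚ
Up (open′ L U _) = U
Up (trivial x)   = x

_∈I_ : ℚ → Interval → Set
w ∈I open′ L U _ = (L Data.Rational.< w) × (w Data.Rational.< U)
w ∈I trivial x   = w ≡ x

Hypergraph : ℕ → Set
Hypergraph n = List (List (Fin n))

Solved : ∀ {n} → (Fin n → Interval) → List (Fin n) → Set
Solved I S = Any (λ v → All (λ u → u ≢ v → Up (I v) ≤ Lo (I u)) S) S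

solved? : ∀ {n} (I : Fin n → Interval) (S : List (Fin n)) → Dec (Solved I S)
solved? I S = any? (λ v → all? (λ u → ¬? (u ≟ᶠ v) →-dec (Up (I v) ≤? Lo (I u))) S) S

AllSolved : ∀ {n} → (Fin n → Interval) → Hypergraph n → Set
AllSolved I E = All (Solved I) E

allSolved? : ∀ {n} (I : Fin n → Interval) (E : Hypergraph n) → Dec (AllSolved I E)
allSolved? I E = all? (solved? I) E

reveal : ∀ {n} → (Fin n → Interval) → (Fin n → ℚ) → (Fin n → Bool) → Fin n → Interval
reveal I w q v = if q v then trivial (w v) else I v

record Instance : Set where
  field
    n         : ℕ
    edges     : Hypergraph n
    intervals : Fin n → Interval
    predicted : Fin n → ℚ
    weights   : Fin n → ℚ
    predicted∈ : ∀ v → predicted v ∈I intervals v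
    weights∈   : ∀ v → weights v ∈I intervals v
open Instance public

kHash : Instance → ℕ
kHash inst = length (filter (λ v → ¬? (weights inst v ≟ predicted inst v)) (allFin (n inst)))

Feasible : (inst : Instance) → Subset (n inst) → Set
Feasible inst Q = AllSolved (reveal (intervals inst) (weights inst) (λ v → lookup Q v)) (edges inst)

IsOPT : (inst : Instance) → Subset (n inst) → Set
IsOPT inst Q = Feasible inst Q × (∀ Q′ → Feasible inst Q′ → ∣ Q ∣ ℕ.≤ ∣ Q′ ∣)

IsSimpleGraph : ∀ {n} → Hypergraph n → Set
IsSimpleGraph E = All (λ S → ∃₂ λ u v → (u Data.Fin.<  v) × (S ≡ u ∷ v ∷ [])) E × Unique E

History : ℕ → Set
History n = List (Fin n × ℚ)

-- A deterministic (adaptive) algorithm: given the public information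
-- (hypergraph, intervals, predictions) and the history of queries so far,
-- it chooses the next vertex to query (or `nothing` to stop).
Algorithm : Set
Algorithm = ∀ {n} → Hypergraph n → (Fin n → Interval) → (Fin n → ℚ) → History n → Maybe (Fin n)

queried : ∀ {n} → History n → Fin n → Bool
queried h v = does (any? (λ p → v ≟ᶠ proj₁ p) h)

currentIntervals : (inst : Instance) → History (n inst) → Fin (n inst) → Interval
currentIntervals inst h = reveal (intervals inst) (weights inst) (queried h)

run : Algorithm → (inst : Instance) → ℕ → History (n inst)
run A inst zero = []
run A inst (suc t) with run A inst t
... | h with does (allSolved? (currentIntervals inst h) (edges inst))
...   | true  = h
...   | false with A (edges inst) (intervals inst) (predicted inst) h
...     | nothing = h
...     | just v  = h ++ ((v , weights inst v) ∷ [])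

MoreThanQueries : Algorithm → (inst : Instance) → ℚ → ℕ → Set
MoreThanQueries A inst ρ m =
  ∀ t → (+ t / 1) ≤ ρ * (+ m / 1) →
    ¬ AllSolved (currentIntervals inst (run A inst t)) (edges inst)

{-# OPTIONS --safe #-}
module Submission where

-- Adversary argument on the single edge {v₀, v₁} with I₀ = (0, 2), I₁ = (1, 3) and both
-- weights predicted as 3/2. The algorithm's first query depends only on public data, so the
-- adversary can make that vertex correctly predicted: its weight 3/2 lies in the other
-- interval and leaves the edge unsolved. The other vertex is mispredicted (1/2 for v₀,
-- 5/2 for v₁), which puts it outside the overlap (1, 2), so querying it alone is optimal.
-- Hence the algorithm needs 2 queries against |OPT| = 1.

open import Defs
open import Data.Nat using (_≤_)
open import Data.Integer using (+_)
open import Data.Rational using (ℚ; _<_; _/_)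
open import Data.Fin.Subset using (Subset; ∣_∣)
open import Data.Product using (Σ; _×_)

open import Data.Bool using (Bool; true; false)
open import Data.Empty using (⊥-elim)
open import Data.Fin using (Fin; zero; suc)
open import Data.Fin.Subset using (⊥; inside; outside)
open import Data.List using ([]; _∷_)
import Data.List.Relation.Unary.All as All
open import Data.List.Relation.Unary.All using ([]; _∷_)
open import Data.List.Relation.Unary.AllPairs using ([]; _∷_)
import Data.List.Relation.Unary.Any as Any
open import Data.Maybe using (Maybe; just; nothing; maybe)
import Data.Nat as ℕ
import Data.Nat.Properties as ℕ
import Data.Nat.Coprimality as Coprime
import Data.Integer as ℤ
import Data.Integer.Properties as ℤ
import Data.Rational as ℚ
import Data.Rational.Properties as ℚ
open import Data.Product using (_,_)
open import Data.Vec using ([]; _∷_; lookup)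
open import Data.Vec.Properties using (lookup-replicate)
open import Relation.Binary.PropositionalEquality
  using (_≡_; _≗_; refl; sym; cong; subst; subst₂)
open import Relation.Nullary using (¬_; yes; no)
open import Relation.Nullary.Decidable using (True; False; toWitness; toWitnessFalse)

+n/1≡mkℚ : ∀ n → + n / 1 ≡ ℚ.mkℚ (+ n) 0 (Coprime.sym (Coprime.1-coprimeTo n))
+n/1≡mkℚ n = ℚ.normalize-coprime (Coprime.sym (Coprime.1-coprimeTo n))

+/1-cancel-< : ∀ {m n} → + m / 1 < + n / 1 → m ℕ.< n
+/1-cancel-< {m} {n} m<n
  rewrite +n/1≡mkℚ m | +n/1≡mkℚ n
  = ℤ.drop‿+<+ (subst₂ ℤ._<_ (ℤ.*-identityʳ (+ m)) (ℤ.*-identityʳ (+ n)) (ℚ.drop-*<* m<n))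

∣p∣≡0⇒p≡⊥ : ∀ {n} {p : Subset n} → ∣ p ∣ ≡ 0 → p ≡ ⊥
∣p∣≡0⇒p≡⊥ {p = []}          _  = refl
∣p∣≡0⇒p≡⊥ {p = outside ∷ p} eq = cong (outside ∷_) (∣p∣≡0⇒p≡⊥ eq)

reveal-⊥ : ∀ {n} (I : Fin n → Interval) (w : Fin n → ℚ) → reveal I w (lookup ⊥) ≗ I
reveal-⊥ I w v rewrite lookup-replicate v false = refl

AllSolved-resp-≗ : ∀ {n} {I J : Fin n → Interval} {E : Hypergraph n} →
  I ≗ J → AllSolved I E → AllSolved J E
AllSolved-resp-≗ I≗J = All.map (Any.map (All.map λ below u≢v →
  subst₂ ℚ._≤_ (cong Up (I≗J _)) (cong Lo (I≗J _)) (below u≢v)))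

feasible⇒nonempty : ∀ inst Q → ¬ AllSolved (intervals inst) (edges inst) →
  Feasible inst Q → 1 ≤ ∣ Q ∣
feasible⇒nonempty inst Q unsolved feasible = ℕ.n≢0⇒n>0 λ ∣Q∣≡0 →
  unsolved (AllSolved-resp-≗ (reveal-⊥ (intervals inst) (weights inst))
    (subst (Feasible inst) (∣p∣≡0⇒p≡⊥ {p = Q} ∣Q∣≡0) feasible))

firstQuery : ∀ inst → Maybe (Fin (n inst)) → History (n inst)
firstQuery inst = maybe (λ v → (v , weights inst v) ∷ []) []

run-1 : (A : Algorithm) (inst : Instance) → ¬ AllSolved (intervals inst) (edges inst) →
  run A inst 1 ≡ firstQuery inst (A (edges inst) (intervals inst) (predicted inst) [])
run-1 A inst unsolved with allSolved? (currentIntervals inst []) (edges inst)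
... | yes solved = ⊥-elim (unsolved solved)
... | no _ with A (edges inst) (intervals inst) (predicted inst) []
...   | nothing = refl
...   | just v  = refl

moreThanQueries-1 : (A : Algorithm) (inst : Instance) {ρ : ℚ} → ρ < + 2 / 1 →
  (∀ t → t ℕ.< 2 → ¬ AllSolved (currentIntervals inst (run A inst t)) (edges inst)) →
  MoreThanQueries A inst ρ 1
moreThanQueries-1 A inst {ρ} ρ<2 unsolved t t≤ρ =
  unsolved t (+/1-cancel-< (ℚ.≤-<-trans (subst (+ t / 1 ℚ.≤_) (ℚ.*-identityʳ ρ) t≤ρ) ρ<2))

2ℚ 3ℚ ½ 3/2 5/2 : ℚ
2ℚ  = + 2 / 1
3ℚ  = + 3 / 1
½   = + 1 / 2
3/2 = + 3 / 2
5/2 = + 5 / 2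

<-by-computation : ∀ {p q} {_ : True (p ℚ.<? q)} → p < q
<-by-computation {_} {_} {p<q} = toWitness p<q

feasible-by-computation : ∀ inst Q
  {_ : True (allSolved? (reveal (intervals inst) (weights inst) (lookup Q)) (edges inst))} →
  Feasible inst Q
feasible-by-computation _ _ {feasible} = toWitness feasible

unsolved-by-computation : ∀ inst h
  {_ : False (allSolved? (currentIntervals inst h) (edges inst))} →
  ¬ AllSolved (currentIntervals inst h) (edges inst)
unsolved-by-computation _ _ {unsolved} = toWitnessFalse unsolved

edge : Hypergraph 2
edge = (zero ∷ suc zero ∷ []) ∷ []

edge-simple : IsSimpleGraph edge
edge-simple = ((zero , suc zero , ℕ.s≤s ℕ.z≤n , refl) ∷ []) , ([] ∷ [])

bounds : Fin 2 → Interval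
bounds zero       = open′ ℚ.0ℚ 2ℚ <-by-computation
bounds (suc zero) = open′ ℚ.1ℚ 3ℚ <-by-computation

prediction : Fin 2 → ℚ
prediction _ = 3/2

prediction∈bounds : ∀ v → prediction v ∈I bounds v
prediction∈bounds zero       = <-by-computation , <-by-computation
prediction∈bounds (suc zero) = <-by-computation , <-by-computation

queries-v₁ : Maybe (Fin 2) → Bool
queries-v₁ (just (suc zero)) = true
queries-v₁ _                 = false

adversaryWeights : Bool → Fin 2 → ℚ
adversaryWeights true  zero       = ½
adversaryWeights true  (suc zero) = 3/2
adversaryWeights false zero       = 3/2
adversaryWeights false (suc zero) = 5/2

adversaryWeights∈bounds : ∀ v₁-first v → adversaryWeights v₁-first v ∈I bounds v
adversaryWeights∈bounds true  zero       = <-by-computation , <-by-computation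
adversaryWeights∈bounds true  (suc zero) = <-by-computation , <-by-computation
adversaryWeights∈bounds false zero       = <-by-computation , <-by-computation
adversaryWeights∈bounds false (suc zero) = <-by-computation , <-by-computation

adversary : Bool → Instance
adversary v₁-first = record
  { n          = 2
  ; edges      = edge
  ; intervals  = bounds
  ; predicted  = prediction
  ; weights    = adversaryWeights v₁-first
  ; predicted∈ = prediction∈bounds
  ; weights∈   = adversaryWeights∈bounds v₁-first
  }

bounds-unsolved : ¬ AllSolved bounds edge
bounds-unsolved = unsolved-by-computation (adversary false) []

firstQuery-insufficient : ∀ m → let inst = adversary (queries-v₁ m) in
  ¬ AllSolved (currentIntervals inst (firstQuery inst m)) edge
firstQuery-insufficient nothing           = unsolved-by-computation (adversary false) []
firstQuery-insufficient (just zero)       = unsolved-by-computation (adversary false) ((zero , 3/2) ∷ [])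
firstQuery-insufficient (just (suc zero)) = unsolved-by-computation (adversary true) ((suc zero , 3/2) ∷ [])

mispredicted : ∀ v₁-first → 1 ≤ kHash (adversary v₁-first)
mispredicted true  = ℕ.s≤s ℕ.z≤n
mispredicted false = ℕ.s≤s ℕ.z≤n

optimum : Bool → Subset 2
optimum true  = inside ∷ outside ∷ []
optimum false = outside ∷ inside ∷ []

∣optimum∣≡1 : ∀ v₁-first → ∣ optimum v₁-first ∣ ≡ 1
∣optimum∣≡1 true  = refl
∣optimum∣≡1 false = refl

optimum-feasible : ∀ v₁-first → Feasible (adversary v₁-first) (optimum v₁-first)
optimum-feasible true  = feasible-by-computation (adversary true) (optimum true)
optimum-feasible false = feasible-by-computation (adversary false) (optimum false)

optimum-isOPT : ∀ v₁-first → IsOPT (adversary v₁-first) (optimum v₁-first)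
optimum-isOPT v₁-first = optimum-feasible v₁-first , λ Q feasible →
  subst (_≤ ∣ Q ∣) (sym (∣optimum∣≡1 v₁-first)) (feasible⇒nonempty (adversary v₁-first) Q bounds-unsolved feasible)

adversary-survives-two-rounds : (A : Algorithm) →
  let inst = adversary (queries-v₁ (A edge bounds prediction [])) in
  ∀ t → t ℕ.< 2 → ¬ AllSolved (currentIntervals inst (run A inst t)) edge
adversary-survives-two-rounds A 0 _ = bounds-unsolved
adversary-survives-two-rounds A (ℕ.suc (ℕ.suc _)) (ℕ.s≤s (ℕ.s≤s ()))
adversary-survives-two-rounds A 1 _ =
  subst (λ h → ¬ AllSolved (currentIntervals inst h) edge) (sym (run-1 A inst bounds-unsolved))
    (firstQuery-insufficient first)
  where
  first : Maybe (Fin 2)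
  first = A edge bounds prediction []
  inst : Instance
  inst = adversary (queries-v₁ first)

theorem7 : (A : Algorithm) → (ρ : ℚ) → ρ < (+ 2 / 1) →
    Σ Instance λ inst → (1 ≤ kHash inst) × IsSimpleGraph (edges inst) ×
    Σ (Subset (n inst)) λ Q → IsOPT inst Q × MoreThanQueries A inst ρ ∣ Q ∣
theorem7 A ρ ρ<2 =
  adversary v₁-first , mispredicted v₁-first , edge-simple ,
  optimum v₁-first , optimum-isOPT v₁-first ,
  subst (MoreThanQueries A (adversary v₁-first) ρ) (sym (∣optimum∣≡1 v₁-first))
    (moreThanQueries-1 A (adversary v₁-first) ρ<2 (adversary-survives-two-rounds A))
  where
  v₁-first : Bool
  v₁-first = queries-v₁ (A edge bounds prediction [])
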